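{- For every integer $n\geq 3$, the mixed cycles $C_{2n}$ and $C^{2}_{2n}$ are not determined by their Hermitian spectrum (not DHS).
   Context: A mixed graph has undirected edges and directed edges (ordered pairs $(x,y)$). For vertices $v_1,\dots,v_n$, its Hermitian adjacency matrix $H(X)$ has $(j,k)$ entry $1$ if $v_jv_k$ is an undirected edge, $i$ if $(v_j,v_k)$ is a directed edge, $-i$ if $(v_k,v_j)$ is a directed edge, $0$ otherwise; $\mathrm{Spec}_H(X)$ is its multiset of eigenvalues. Mixed graphs $X,Y$ on the same vertex set are switching equivalent if $H(X)=D^{ -1}H(Y)D$ for a diagonal $D$ with diagonal entries in $\{\pm1,\pm i\}$. A mixed graph $X$ is DHS if every mixed graph $Y$ with $\mathrm{Spec}_H(Y)=\mathrm{Spec}_H(X)$ is switching equivalent to a mixed graph isomorphic to $X$. $C_m$ is the cycle of order $m$ with all edges undirected; $C^2_m$ is the mixed cycle of order $m$ with two consecutive directed edges $(u,v),(v,w)$ with the same direction and all other edges undirected. -}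

module Defs where

open import Data.Nat as ℕ using (ℕ; zero; suc; _∸_)
open import Data.Integer as ℤ using (ℤ; +_; 0ℤ; 1ℤ)
open import Data.Fin using (Fin; zero; suc; toℕ; punchIn; _<?_)
open import Data.Bool using (Bool; true; false; if_then_else_; _∨_; _∧_)
open import Data.Product using (Σ; ∃; _×_; _,_)
open import Relation.Nullary.Decidable using (⌊_⌋; yes; no)
open import Relation.Binary.PropositionalEquality using (_≡_)
open import Function.Bundles using (_↔_; Inverse)
open import Data.Vec.Functional using (foldr)

record ℤ[i] : Set where
  constructor _+_i
  field
    re : ℤ
    im : ℤ
open ℤ[i] public

0g 1g ig : ℤ[i]
0g = 0ℤ + 0ℤ i
1g = 1ℤ + 0ℤ i
ig = 0ℤ + 1ℤ i

_+g_ : ℤ[i] → ℤ[i] → ℤ[i]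
(a + b i) +g (c + d i) = (a ℤ.+ c) + (b ℤ.+ d) i

_*g_ : ℤ[i] → ℤ[i] → ℤ[i]
(a + b i) *g (c + d i) = (a ℤ.* c ℤ.- b ℤ.* d) + (a ℤ.* d ℤ.+ b ℤ.* c) i

-g_ : ℤ[i] → ℤ[i]
-g (a + b i) = (ℤ.- a) + (ℤ.- b) i

_-g_ : ℤ[i] → ℤ[i] → ℤ[i]
x -g y = x +g (-g y)

fromℤ : ℤ → ℤ[i]
fromℤ t = t + 0ℤ i

Matrix : ℕ → Set
Matrix n = Fin n → Fin n → ℤ[i]

signed : ℕ → ℤ[i] → ℤ[i]
signed zero x = x
signed (suc zero) x = -g x
signed (suc (suc k)) x = signed k x

det : ∀ {n} → Matrix n → ℤ[i]
det {zero} M = 1g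
det {suc n} M =
  foldr _+g_ 0g
    (λ k → signed (toℕ k) (M zero k *g det (λ r c → M (suc r) (punchIn k c))))

shift : ∀ {n} → ℤ → Matrix n → Matrix n
shift t M r c = (if ⌊ Data.Fin._≟_ r c ⌋ then fromℤ t else 0g) -g M r c

-- For j < k, (G j k) records the relation between v_j and v_k:
--   none : no edge,  und : undirected edge v_j v_k,
--   fwd  : directed edge (v_j , v_k),  bwd : directed edge (v_k , v_j).
-- Entries with j ≥ k are ignored (only the upper triangle is used), which
-- builds looplessness and consistency into the representation.

data Kind : Set where
  none und fwd bwd : Kind

flipK : Kind → Kind
flipK none = none
flipK und = und
flipK fwd = bwd
flipK bwd = fwd

MixedGraph : ℕ → Set
MixedGraph n = Fin n → Fin n → Kind

kind : ∀ {n} → MixedGraph n → Fin n → Fin n → Kind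
kind G j k with j <? k | k <? j
... | yes _ | _ = G j k
... | no _ | yes _ = flipK (G k j)
... | no _ | no _ = none

entry : Kind → ℤ[i]
entry none = 0g
entry und = 1g
entry fwd = ig
entry bwd = -g ig

H : ∀ {n} → MixedGraph n → Matrix n
H G j k = entry (kind G j k)

-- Same H-spectrum: equal characteristic polynomials det(tI − H),
-- expressed as agreement at every integer t (two polynomials agree as
-- polynomials iff they agree at all integers).
Cospectral : ∀ {n} → MixedGraph n → MixedGraph n → Set
Cospectral X Y = ∀ (t : ℤ) → det (shift t (H X)) ≡ det (shift t (H Y))

unit : Fin 4 → ℤ[i]
unit zero = 1g
unit (suc zero) = ig
unit (suc (suc zero)) = -g 1g
unit (suc (suc (suc zero))) = -g ig

unitInv : Fin 4 → ℤ[i]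
unitInv zero = 1g
unitInv (suc zero) = -g ig
unitInv (suc (suc zero)) = -g 1g
unitInv (suc (suc (suc zero))) = ig

SwitchingEquivalent : ∀ {n} → MixedGraph n → MixedGraph n → Set
SwitchingEquivalent {n} X Y =
  Σ (Fin n → Fin 4) λ d →
    ∀ j k → H X j k ≡ (unitInv (d j) *g H Y j k) *g unit (d k)

Isomorphic : ∀ {n} → MixedGraph n → MixedGraph n → Set
Isomorphic {n} X Y =
  Σ (Fin n ↔ Fin n) λ σ →
    ∀ j k → kind Y (Inverse.to σ j) (Inverse.to σ k) ≡ kind X j k

DHS : ∀ {n} → MixedGraph n → Set
DHS {n} X =
  ∀ (Y : MixedGraph n) → Cospectral Y X →
    Σ (MixedGraph n) λ Z → SwitchingEquivalent Y Z × Isomorphic Z X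

eqℕ : ℕ → ℕ → Bool
eqℕ a b = ⌊ a ℕ.≟ b ⌋

cycAdj : (m : ℕ) → Fin m → Fin m → Bool
cycAdj m j k = eqℕ (toℕ k) (suc (toℕ j)) ∨ (eqℕ (toℕ j) 0 ∧ eqℕ (toℕ k) (m ∸ 1))

Cyc : (m : ℕ) → MixedGraph m
Cyc m j k = if cycAdj m j k then und else none

Cyc2 : (m : ℕ) → MixedGraph m
Cyc2 m j k =
  if (eqℕ (toℕ j) 0 ∧ eqℕ (toℕ k) 1) ∨ (eqℕ (toℕ j) 1 ∧ eqℕ (toℕ k) 2)
  then fwd
  else Cyc m j k

-- For a mixed cycle on m ≥ 3 vertices whose H-entries multiply to w along the cycle, expanding
-- det(tI − H) along the first row and column gives L_m(t) − (w + w̄), where L_m is the Vieta–Lucas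
-- polynomial, L_m(x + x⁻¹) = xᵐ + x⁻ᵐ. Since L_{2n} = L_n² − 2, the cycle C_{2n} (w = 1) is cospectral
-- with the disjoint union of C_n and the cycle with two consecutive arcs (w = i² = −1), and C²_{2n}
-- (w = −1) with two copies of the n-cycle with a single arc (w = i):
--   (L_n − 2)(L_n + 2) = L_{2n} − 2   and   L_n · L_n = L_{2n} + 2.
-- Switching preserves non-edges and isomorphism preserves the Hamiltonian path 0 – 1 – ⋯ – (2n−1),
-- so no graph isomorphic to the cycle is switching equivalent to its disconnected mate.
{-# OPTIONS --safe #-}
module Submission where

open import Defs

open import Algebra.Bundles using (CommutativeRing)
open import Data.Bool using (Bool; true; false; if_then_else_; _∨_; _∧_)
open import Data.Bool.Properties using (∨-identityʳ)
open import Data.Empty using (⊥-elim)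
open import Data.Fin using (Fin; zero; suc; toℕ; fromℕ; punchIn; inject₁; _↑ˡ_; _↑ʳ_)
import Data.Fin as Fin
open import Data.Fin.Properties
  using (suc-injective; toℕ-fromℕ; toℕ-↑ˡ; toℕ-↑ʳ; toℕ-injective; toℕ-inject₁; toℕ<n)
open import Data.Integer using (ℤ; 0ℤ; 1ℤ)
import Data.Integer as Int
import Data.Integer.Properties as ℤₚ
import Data.Integer.Tactic.RingSolver as ℤ-Solver
open import Data.List using (_∷_; [])
open import Data.Maybe using (just; nothing)
open import Data.Nat using (_≤_; _*_)
open import Data.Nat as ℕ using (ℕ; zero; suc; z≤n; s≤s; _∸_)
import Data.Nat.Properties as ℕ
open import Data.Product using (_×_; _,_)
open import Function using (_∘_; flip)
open import Function.Bundles using (Inverse)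
open import Level using (0ℓ)
open import Relation.Binary.Definitions using (tri<; tri≈; tri>)
open import Relation.Binary.PropositionalEquality
open import Relation.Nullary using (¬_; Dec; yes; no)
open import Relation.Nullary.Decidable using (⌊_⌋; isYes≗does; dec-true; dec-false)
open import Algebra.Structures {A = ℤ[i]} _≡_ using (IsCommutativeRing)
import Tactic.RingSolver as Solver
import Tactic.RingSolver.Core.AlmostCommutativeRing as ACR

module GaussianIntegers where

  open Int using (_-_) renaming (_+_ to _⊕_; _*_ to _⊗_)

  ≡-ℤ[i] : ∀ {a b c d} → a ≡ c → b ≡ d → a + b i ≡ c + d i
  ≡-ℤ[i] refl refl = refl

  +g-assoc : ∀ x y z → (x +g y) +g z ≡ x +g (y +g z)
  +g-assoc (a + b i) (c + d i) (e + f i) = ≡-ℤ[i] (ℤₚ.+-assoc a c e) (ℤₚ.+-assoc b d f)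

  +g-comm : ∀ x y → x +g y ≡ y +g x
  +g-comm (a + b i) (c + d i) = ≡-ℤ[i] (ℤₚ.+-comm a c) (ℤₚ.+-comm b d)

  +g-identityˡ : ∀ x → 0g +g x ≡ x
  +g-identityˡ (a + b i) = ≡-ℤ[i] (ℤₚ.+-identityˡ a) (ℤₚ.+-identityˡ b)

  +g-identityʳ : ∀ x → x +g 0g ≡ x
  +g-identityʳ (a + b i) = ≡-ℤ[i] (ℤₚ.+-identityʳ a) (ℤₚ.+-identityʳ b)

  -g-inverseˡ : ∀ x → (-g x) +g x ≡ 0g
  -g-inverseˡ (a + b i) = ≡-ℤ[i] (ℤₚ.+-inverseˡ a) (ℤₚ.+-inverseˡ b)

  -g-inverseʳ : ∀ x → x +g (-g x) ≡ 0g
  -g-inverseʳ (a + b i) = ≡-ℤ[i] (ℤₚ.+-inverseʳ a) (ℤₚ.+-inverseʳ b)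

  *g-assoc : ∀ x y z → (x *g y) *g z ≡ x *g (y *g z)
  *g-assoc (a + b i) (c + d i) (e + f i) = ≡-ℤ[i] (re-assoc a b c d e f) (im-assoc a b c d e f)
    where
    re-assoc : ∀ a b c d e f →
      (a ⊗ c - b ⊗ d) ⊗ e - (a ⊗ d ⊕ b ⊗ c) ⊗ f ≡ a ⊗ (c ⊗ e - d ⊗ f) - b ⊗ (c ⊗ f ⊕ d ⊗ e)
    re-assoc = ℤ-Solver.solve-∀
    im-assoc : ∀ a b c d e f →
      (a ⊗ c - b ⊗ d) ⊗ f ⊕ (a ⊗ d ⊕ b ⊗ c) ⊗ e ≡ a ⊗ (c ⊗ f ⊕ d ⊗ e) ⊕ b ⊗ (c ⊗ e - d ⊗ f)
    im-assoc = ℤ-Solver.solve-∀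

  *g-comm : ∀ x y → x *g y ≡ y *g x
  *g-comm (a + b i) (c + d i) = ≡-ℤ[i] (re-comm a b c d) (im-comm a b c d)
    where
    re-comm : ∀ a b c d → a ⊗ c - b ⊗ d ≡ c ⊗ a - d ⊗ b
    re-comm = ℤ-Solver.solve-∀
    im-comm : ∀ a b c d → a ⊗ d ⊕ b ⊗ c ≡ c ⊗ b ⊕ d ⊗ a
    im-comm = ℤ-Solver.solve-∀

  *g-identityˡ : ∀ x → 1g *g x ≡ x
  *g-identityˡ (a + b i) = ≡-ℤ[i] (re-identity a b) (im-identity a b)
    where
    re-identity : ∀ a b → 1ℤ ⊗ a - 0ℤ ⊗ b ≡ a
    re-identity = ℤ-Solver.solve-∀
    im-identity : ∀ a b → 1ℤ ⊗ b ⊕ 0ℤ ⊗ a ≡ b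
    im-identity = ℤ-Solver.solve-∀

  *g-distribˡ : ∀ x y z → x *g (y +g z) ≡ (x *g y) +g (x *g z)
  *g-distribˡ (a + b i) (c + d i) (e + f i) = ≡-ℤ[i] (re-distrib a b c d e f) (im-distrib a b c d e f)
    where
    re-distrib : ∀ a b c d e f → a ⊗ (c ⊕ e) - b ⊗ (d ⊕ f) ≡ (a ⊗ c - b ⊗ d) ⊕ (a ⊗ e - b ⊗ f)
    re-distrib = ℤ-Solver.solve-∀
    im-distrib : ∀ a b c d e f → a ⊗ (d ⊕ f) ⊕ b ⊗ (c ⊕ e) ≡ (a ⊗ d ⊕ b ⊗ c) ⊕ (a ⊗ f ⊕ b ⊗ e)
    im-distrib = ℤ-Solver.solve-∀

  isCommutativeRing : IsCommutativeRing _+g_ _*g_ (λ x → -g x) 0g 1g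
  isCommutativeRing = record
    { isRing = record
      { +-isAbelianGroup = record
        { isGroup = record
          { isMonoid = record
            { isSemigroup = record
              { isMagma = record { isEquivalence = isEquivalence ; ∙-cong = cong₂ _+g_ }
              ; assoc = +g-assoc }
            ; identity = +g-identityˡ , +g-identityʳ }
          ; inverse = -g-inverseˡ , -g-inverseʳ
          ; ⁻¹-cong = cong (λ x → -g x) }
        ; comm = +g-comm }
      ; *-cong = cong₂ _*g_
      ; *-assoc = *g-assoc
      ; *-identity = *g-identityˡ , λ x → trans (*g-comm x 1g) (*g-identityˡ x)
      ; distrib = *g-distribˡ , λ x y z → trans (*g-comm (y +g z) x)
                    (trans (*g-distribˡ x y z) (cong₂ _+g_ (*g-comm x y) (*g-comm x z))) }
    ; *-comm = *g-comm }

  commutativeRing : CommutativeRing 0ℓ 0ℓ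
  commutativeRing = record { isCommutativeRing = isCommutativeRing }

  ring : ACR.AlmostCommutativeRing 0ℓ 0ℓ
  ring = ACR.fromCommutativeRing commutativeRing λ { ((Int.+ 0) + (Int.+ 0) i) → just refl ; _ → nothing }

open GaussianIntegers using (commutativeRing; ring)
open CommutativeRing commutativeRing
  using (zeroˡ; zeroʳ; *-identityˡ; *-identityʳ; +-identityˡ; +-identityʳ; +-assoc; *-assoc; distribˡ)
open import Algebra.Properties.Semiring.Sum (CommutativeRing.semiring commutativeRing)
  using (sum; sum-cong-≗; sum-replicate-zero; sum-init-last; ∑-distrib-+; *-distribˡ-sum; *-distribʳ-sum)

sum-zero : ∀ {n} {f : Fin n → ℤ[i]} → (∀ k → f k ≡ 0g) → sum f ≡ 0g
sum-zero {n} f≡0 = trans (sum-cong-≗ f≡0) (sum-replicate-zero n)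

sum-++ : ∀ m {n} (f : Fin (m ℕ.+ n) → ℤ[i]) →
  sum f ≡ sum (λ i → f (i ↑ˡ n)) +g sum (λ j → f (m ↑ʳ j))
sum-++ zero    f = sym (+-identityˡ (sum f))
sum-++ (suc m) f = trans (cong (f zero +g_) (sum-++ m (f ∘ suc))) (sym (+-assoc (f zero) _ _))

sign : ℕ → ℤ[i]
sign k = signed k 1g

signed≡sign* : ∀ k x → signed k x ≡ sign k *g x
signed≡sign* zero          x = sym (*-identityˡ x)
signed≡sign* (suc zero)    x = begin -g x ≡⟨ Solver.solve (x ∷ []) ring ⟩ (-g 1g) *g x ∎
  where open ≡-Reasoning
signed≡sign* (suc (suc k)) x = signed≡sign* k x

sign-suc : ∀ k → sign (suc k) ≡ -g sign k
sign-suc zero          = refl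
sign-suc (suc zero)    = refl
sign-suc (suc (suc k)) = sign-suc k

sign-square : ∀ k → (sign k *g sign k) ≡ 1g
sign-square zero          = refl
sign-square (suc zero)    = refl
sign-square (suc (suc k)) = sign-square k

signed-+ : ∀ k x y → signed k (x +g y) ≡ (signed k x +g signed k y)
signed-+ zero          x y = refl
signed-+ (suc zero)    x y = begin -g (x +g y) ≡⟨ Solver.solve (x ∷ y ∷ []) ring ⟩ (-g x) +g (-g y) ∎
  where open ≡-Reasoning
signed-+ (suc (suc k)) x y = signed-+ k x y

signed-involutive : ∀ k x → signed k (signed k x) ≡ x
signed-involutive zero          x = refl
signed-involutive (suc zero)    x = begin -g (-g x) ≡⟨ Solver.solve (x ∷ []) ring ⟩ x ∎
  where open ≡-Reasoning
signed-involutive (suc (suc k)) x = signed-involutive k x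

signed-exchange : ∀ j k b a e →
  signed (suc j) (b *g signed k (a *g e)) ≡ signed (suc k) (a *g signed j (b *g e))
signed-exchange j k b a e = begin
  signed (suc j) (b *g signed k (a *g e))
    ≡⟨ trans (signed≡sign* (suc j) _) (cong₂ (λ s t → s *g (b *g t)) (sign-suc j) (signed≡sign* k _)) ⟩
  (-g sign j) *g (b *g (sign k *g (a *g e)))
    ≡⟨ exchange (sign j) (sign k) ⟩
  (-g sign k) *g (a *g (sign j *g (b *g e)))
    ≡⟨ sym (trans (signed≡sign* (suc k) _) (cong₂ (λ s t → s *g (a *g t)) (sign-suc k) (signed≡sign* j _))) ⟩
  signed (suc k) (a *g signed j (b *g e)) ∎
  where
  open ≡-Reasoning
  exchange : ∀ s t → ((-g s) *g (b *g (t *g (a *g e)))) ≡ ((-g t) *g (a *g (s *g (b *g e))))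
  exchange s t = Solver.solve (s ∷ t ∷ a ∷ b ∷ e ∷ []) ring

signed-*-+ : ∀ k c x y → signed k (c *g (x +g y)) ≡ (signed k (c *g x) +g signed k (c *g y))
signed-*-+ k c x y = begin
  signed k (c *g (x +g y))                ≡⟨ signed≡sign* k _ ⟩
  sign k *g (c *g (x +g y))               ≡⟨ cong (sign k *g_) (distribˡ c x y) ⟩
  sign k *g ((c *g x) +g (c *g y))        ≡⟨ distribˡ (sign k) _ _ ⟩
  (sign k *g (c *g x)) +g (sign k *g (c *g y)) ≡⟨ sym (cong₂ _+g_ (signed≡sign* k _) (signed≡sign* k _)) ⟩
  (signed k (c *g x) +g signed k (c *g y))  ∎
  where open ≡-Reasoning

sum-signed-* : ∀ k a {n} (f : Fin n → ℤ[i]) → sum (λ j → signed k (a *g f j)) ≡ signed k (a *g sum f)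
sum-signed-* k a f = begin
  sum (λ j → signed k (a *g f j))
    ≡⟨ sum-cong-≗ (λ j → trans (signed≡sign* k _) (sym (*-assoc (sign k) a (f j)))) ⟩
  sum (λ j → (sign k *g a) *g f j)  ≡⟨ sym (*-distribˡ-sum (sign k *g a) f) ⟩
  (sign k *g a) *g sum f            ≡⟨ *-assoc (sign k) a (sum f) ⟩
  sign k *g (a *g sum f)            ≡⟨ sym (signed≡sign* k _) ⟩
  signed k (a *g sum f)             ∎
  where open ≡-Reasoning

signed-0* : ∀ k {a} d → a ≡ 0g → signed k (a *g d) ≡ 0g
signed-0* k d refl = trans (signed≡sign* k _) (trans (cong (sign k *g_) (zeroˡ d)) (zeroʳ (sign k)))

signed-*0 : ∀ k a {d} → d ≡ 0g → signed k (a *g d) ≡ 0g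
signed-*0 k a refl = trans (signed≡sign* k _) (trans (cong (sign k *g_) (zeroʳ a)) (zeroʳ (sign k)))

minor : ∀ {n} → Matrix (suc n) → Fin (suc n) → Fin (suc n) → Matrix n
minor M p q r c = M (punchIn p r) (punchIn q c)

-- `det M` is definitionally `sum (expansion M)`, the Laplace expansion along row 0.
expansion : ∀ {n} → Matrix (suc n) → Fin (suc n) → ℤ[i]
expansion M k = signed (toℕ k) (M zero k *g det (minor M zero k))

det-cong : ∀ {n} {A B : Matrix n} → (∀ r c → A r c ≡ B r c) → det A ≡ det B
det-cong {zero}  A≗B = refl
det-cong {suc n} A≗B = sum-cong-≗ λ k →
  cong₂ (λ a d → signed (toℕ k) (a *g d)) (A≗B zero k) (det-cong λ r c → A≗B (suc r) (punchIn k c))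

det-zeroFirstColumn : ∀ {n} (M : Matrix (suc n)) → (∀ r → M r zero ≡ 0g) → det M ≡ 0g
det-zeroFirstColumn {zero}  M col≡0 = sum-zero {f = expansion M} λ { zero → signed-0* 0 1g (col≡0 zero) }
det-zeroFirstColumn {suc n} M col≡0 = sum-zero {f = expansion M} λ
  { zero    → signed-0* 0 (det (minor M zero zero)) (col≡0 zero)
  ; (suc k) → signed-*0 (toℕ (suc k)) (M zero (suc k)) (det-zeroFirstColumn (minor M zero (suc k)) (col≡0 ∘ suc)) }

det-sparseFirstColumn : ∀ {n} (M : Matrix (suc n)) r₀ → (∀ r → r ≢ r₀ → M r zero ≡ 0g) →
  det M ≡ signed (toℕ r₀) (M r₀ zero *g det (minor M r₀ zero))
det-sparseFirstColumn {zero}  M zero     _      = +-identityʳ _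
det-sparseFirstColumn {suc n} M zero     col≡0 =
  trans (cong (expansion M zero +g_) (sum-zero {f = expansion M ∘ suc} λ j →
           signed-*0 (toℕ (suc j)) (M zero (suc j))
             (det-zeroFirstColumn (minor M zero (suc j)) λ r → col≡0 (suc r) λ ())))
        (+-identityʳ (expansion M zero))
det-sparseFirstColumn {suc n} M (suc r₁) col≡0 = begin
  det M
    ≡⟨ cong₂ _+g_ (signed-0* 0 (det (minor M zero zero)) (col≡0 zero λ ()))
                  (sum-cong-≗ λ j → cong (λ d → signed (toℕ (suc j)) (M zero (suc j) *g d))
                    (det-sparseFirstColumn (minor M zero (suc j)) r₁ λ r r≢r₁ →
                      col≡0 (suc r) (r≢r₁ ∘ suc-injective))) ⟩
  0g +g sum (λ j → signed (suc (toℕ j)) (M zero (suc j) *g signed (toℕ r₁) (a *g E j)))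
    ≡⟨ +-identityˡ _ ⟩
  sum (λ j → signed (suc (toℕ j)) (M zero (suc j) *g signed (toℕ r₁) (a *g E j)))
    ≡⟨ sum-cong-≗ (λ j → signed-exchange (toℕ j) (toℕ r₁) (M zero (suc j)) a (E j)) ⟩
  sum (λ j → signed (suc (toℕ r₁)) (a *g signed (toℕ j) (M zero (suc j) *g E j)))
    ≡⟨ sum-signed-* (suc (toℕ r₁)) a (expansion (minor M (suc r₁) zero)) ⟩
  signed (suc (toℕ r₁)) (a *g det (minor M (suc r₁) zero)) ∎
  where
  open ≡-Reasoning
  a : ℤ[i]
  a = M (suc r₁) zero
  E : Fin (suc n) → ℤ[i]
  E j = det (minor (minor M zero (suc j)) r₁ zero)

det-additiveFirstColumn : ∀ {n} (A B C : Matrix (suc n)) →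
  (∀ r → C r zero ≡ (A r zero +g B r zero)) →
  (∀ r c → A r (suc c) ≡ C r (suc c)) → (∀ r c → B r (suc c) ≡ C r (suc c)) →
  det C ≡ (det A +g det B)
det-additiveFirstColumn {zero} A B C C≡A+B _ _ = begin
  (C zero zero *g 1g) +g 0g                                  ≡⟨ cong (λ x → (x *g 1g) +g 0g) (C≡A+B zero) ⟩
  ((A zero zero +g B zero zero) *g 1g) +g 0g                 ≡⟨ split (A zero zero) (B zero zero) ⟩
  ((A zero zero *g 1g) +g 0g) +g ((B zero zero *g 1g) +g 0g) ∎
  where
  open ≡-Reasoning
  split : ∀ a b → (((a +g b) *g 1g) +g 0g) ≡ (((a *g 1g) +g 0g) +g ((b *g 1g) +g 0g))
  split a b = Solver.solve (a ∷ b ∷ []) ring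
det-additiveFirstColumn {suc n} A B C C≡A+B A≡C B≡C = begin
  det C
    ≡⟨ cong₂ _+g_ (cong (_*g d) (C≡A+B zero)) (sum-cong-≗ λ j →
         trans (cong (λ x → signed (toℕ (suc j)) (C zero (suc j) *g x)) (minor-additive j))
               (signed-*-+ (toℕ (suc j)) (C zero (suc j)) (det (minor A zero (suc j))) (det (minor B zero (suc j))))) ⟩
  ((a +g b) *g d) +g sum (λ j → tA j +g tB j)
    ≡⟨ cong (((a +g b) *g d) +g_) (∑-distrib-+ tA tB) ⟩
  ((a +g b) *g d) +g (sum tA +g sum tB)
    ≡⟨ regroup a b d (sum tA) (sum tB) ⟩
  ((a *g d) +g sum tA) +g ((b *g d) +g sum tB)
    ≡⟨ cong₂ _+g_ (cong₂ _+g_ (cong (a *g_) (det-cong λ r c → sym (A≡C (suc r) c)))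
                              (sum-cong-≗ λ j → cong (λ x → signed (toℕ (suc j)) (x *g det (minor A zero (suc j))))
                                                     (sym (A≡C zero j))))
                  (cong₂ _+g_ (cong (b *g_) (det-cong λ r c → sym (B≡C (suc r) c)))
                              (sum-cong-≗ λ j → cong (λ x → signed (toℕ (suc j)) (x *g det (minor B zero (suc j))))
                                                     (sym (B≡C zero j)))) ⟩
  det A +g det B ∎
  where
  open ≡-Reasoning
  a b d : ℤ[i]
  a = A zero zero
  b = B zero zero
  d = det (minor C zero zero)
  tA tB : Fin (suc n) → ℤ[i]
  tA j = signed (toℕ (suc j)) (C zero (suc j) *g det (minor A zero (suc j)))
  tB j = signed (toℕ (suc j)) (C zero (suc j) *g det (minor B zero (suc j)))
  minor-additive : ∀ j → det (minor C zero (suc j)) ≡ (det (minor A zero (suc j)) +g det (minor B zero (suc j)))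
  minor-additive j = det-additiveFirstColumn (minor A zero (suc j)) (minor B zero (suc j)) (minor C zero (suc j))
    (C≡A+B ∘ suc) (λ r c → A≡C (suc r) (punchIn j c)) (λ r c → B≡C (suc r) (punchIn j c))
  regroup : ∀ a b d x y → (((a +g b) *g d) +g (x +g y)) ≡ (((a *g d) +g x) +g ((b *g d) +g y))
  regroup a b d x y = Solver.solve (a ∷ b ∷ d ∷ x ∷ y ∷ []) ring

det-twoEntryFirstColumn : ∀ {n} (M : Matrix (suc (suc n))) →
  (∀ r → r ≢ zero → r ≢ fromℕ (suc n) → M r zero ≡ 0g) →
  det M ≡ ((M zero zero *g det (minor M zero zero)) +g
           signed (suc n) (M (fromℕ (suc n)) zero *g det (minor M (fromℕ (suc n)) zero)))
det-twoEntryFirstColumn {n} M col≡0 =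
  trans (det-additiveFirstColumn A B M M≡A+B (λ _ _ → refl) (λ _ _ → refl))
        (cong₂ _+g_ (det-sparseFirstColumn A zero A-sparse)
                    (trans (det-sparseFirstColumn B (fromℕ (suc n)) B-sparse)
                           (cong (λ k → signed k (M (fromℕ (suc n)) zero *g det (minor M (fromℕ (suc n)) zero)))
                                 (toℕ-fromℕ (suc n)))))
  where
  A B : Matrix (suc (suc n))
  A r       (suc c) = M r (suc c)
  A zero    zero    = M zero zero
  A (suc r) zero    = 0g
  B r       (suc c) = M r (suc c)
  B zero    zero    = 0g
  B (suc r) zero    = M (suc r) zero
  M≡A+B : ∀ r → M r zero ≡ (A r zero +g B r zero)
  M≡A+B zero    = sym (+-identityʳ (M zero zero))
  M≡A+B (suc r) = sym (+-identityˡ (M (suc r) zero))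
  A-sparse : ∀ r → r ≢ zero → A r zero ≡ 0g
  A-sparse zero    r≢0 = ⊥-elim (r≢0 refl)
  A-sparse (suc r) _   = refl
  B-sparse : ∀ r → r ≢ fromℕ (suc n) → B r zero ≡ 0g
  B-sparse zero    _     = refl
  B-sparse (suc r) r≢last = col≡0 (suc r) (λ ()) r≢last

punchIn-↑ˡ : ∀ {m} n (p : Fin (suc m)) (c : Fin m) → punchIn (p ↑ˡ n) (c ↑ˡ n) ≡ punchIn p c ↑ˡ n
punchIn-↑ˡ n zero    c       = refl
punchIn-↑ˡ n (suc p) zero    = refl
punchIn-↑ˡ n (suc p) (suc c) = cong suc (punchIn-↑ˡ n p c)

punchIn-↑ʳ : ∀ m {n} (p : Fin (suc m)) (c : Fin n) → punchIn (p ↑ˡ n) (m ↑ʳ c) ≡ suc m ↑ʳ c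
punchIn-↑ʳ zero    zero    c = refl
punchIn-↑ʳ (suc m) zero    c = refl
punchIn-↑ʳ (suc m) (suc p) c = cong suc (punchIn-↑ʳ m p c)

det-blockTriangular : ∀ m n (M : Matrix (m ℕ.+ n)) →
  (∀ (r : Fin m) (c : Fin n) → M (r ↑ˡ n) (m ↑ʳ c) ≡ 0g) →
  det M ≡ (det (λ r c → M (r ↑ˡ n) (c ↑ˡ n)) *g det (λ r c → M (m ↑ʳ r) (m ↑ʳ c)))
det-blockTriangular zero    n M _       = sym (*-identityˡ (det M))
det-blockTriangular (suc m) n M block≡0 = begin
  det M
    ≡⟨ sum-++ (suc m) (expansion M) ⟩
  sum (λ p → expansion M (p ↑ˡ n)) +g sum (λ c → expansion M (suc m ↑ʳ c))
    ≡⟨ cong₂ _+g_ (sum-cong-≗ upper-term) (sum-zero {f = λ c → expansion M (suc m ↑ʳ c)} λ c →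
         signed-0* (toℕ (suc m ↑ʳ c)) (det (minor M zero (suc m ↑ʳ c))) (block≡0 zero c)) ⟩
  sum (λ p → expansion Top p *g det Bottom) +g 0g
    ≡⟨ +-identityʳ _ ⟩
  sum (λ p → expansion Top p *g det Bottom)
    ≡⟨ sym (*-distribʳ-sum (det Bottom) (expansion Top)) ⟩
  det Top *g det Bottom ∎
  where
  open ≡-Reasoning
  Top : Matrix (suc m)
  Top r c = M (r ↑ˡ n) (c ↑ˡ n)
  Bottom : Matrix n
  Bottom r c = M (suc m ↑ʳ r) (suc m ↑ʳ c)
  minor-factor : ∀ p → det (minor M zero (p ↑ˡ n)) ≡ (det (minor Top zero p) *g det Bottom)
  minor-factor p =
    trans (det-blockTriangular m n (minor M zero (p ↑ˡ n))
            (λ r c → trans (cong (M (suc r ↑ˡ n)) (punchIn-↑ʳ m p c)) (block≡0 (suc r) c)))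
          (cong₂ _*g_ (det-cong λ r c → cong (M (suc r ↑ˡ n)) (punchIn-↑ˡ n p c))
                      (det-cong λ r c → cong (M (suc m ↑ʳ r)) (punchIn-↑ʳ m p c)))
  upper-term : ∀ p → expansion M (p ↑ˡ n) ≡ (expansion Top p *g det Bottom)
  upper-term p = begin
    signed (toℕ (p ↑ˡ n)) (Top zero p *g det (minor M zero (p ↑ˡ n)))
      ≡⟨ cong₂ (λ k d → signed k (Top zero p *g d)) (toℕ-↑ˡ p n) (minor-factor p) ⟩
    signed (toℕ p) (Top zero p *g (det (minor Top zero p) *g det Bottom))
      ≡⟨ trans (signed≡sign* (toℕ p) _) (reassoc (sign (toℕ p)) (Top zero p) (det (minor Top zero p)) (det Bottom)) ⟩
    (sign (toℕ p) *g (Top zero p *g det (minor Top zero p))) *g det Bottom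
      ≡⟨ cong (_*g det Bottom) (sym (signed≡sign* (toℕ p) _)) ⟩
    expansion Top p *g det Bottom ∎
    where
    reassoc : ∀ s a b c → (s *g (a *g (b *g c))) ≡ ((s *g (a *g b)) *g c)
    reassoc s a b c = Solver.solve (s ∷ a ∷ b ∷ c ∷ []) ring

leading : ∀ k → (ℕ → ℕ → ℤ[i]) → Matrix k
leading k F r c = F (toℕ r) (toℕ c)

drop₁ : (ℕ → ℕ → ℤ[i]) → ℕ → ℕ → ℤ[i]
drop₁ F x y = F (suc x) (suc y)

∏ : ℕ → (ℕ → ℤ[i]) → ℤ[i]
∏ zero    f = 1g
∏ (suc k) f = f 0 *g ∏ k (f ∘ suc)

det-lowerTriangular : ∀ k F → (∀ x y → x ℕ.< y → F x y ≡ 0g) → det (leading k F) ≡ ∏ k (λ x → F x x)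
det-lowerTriangular zero    F upper≡0 = refl
det-lowerTriangular (suc k) F upper≡0 = begin
  det (leading (suc k) F)
    ≡⟨ cong₂ _+g_ (cong (F 0 0 *g_) (det-lowerTriangular k (drop₁ F) λ x y x<y → upper≡0 (suc x) (suc y) (s≤s x<y)))
                  (sum-zero {f = expansion (leading (suc k) F) ∘ suc} λ y →
                    signed-0* (toℕ (suc y)) (det (minor (leading (suc k) F) zero (suc y))) (upper≡0 0 (suc (toℕ y)) (s≤s z≤n))) ⟩
  (F 0 0 *g ∏ k (λ x → F (suc x) (suc x))) +g 0g
    ≡⟨ +-identityʳ _ ⟩
  ∏ (suc k) (λ x → F x x) ∎
  where open ≡-Reasoning

det-upperTriangular : ∀ k F → (∀ x y → y ℕ.< x → F x y ≡ 0g) → det (leading k F) ≡ ∏ k (λ x → F x x)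
det-upperTriangular zero    F lower≡0 = refl
det-upperTriangular (suc k) F lower≡0 =
  trans (det-sparseFirstColumn (leading (suc k) F) zero col≡0)
        (cong (F 0 0 *g_) (det-upperTriangular k (drop₁ F) λ x y y<x → lower≡0 (suc x) (suc y) (s≤s y<x)))
  where
  col≡0 : ∀ r → r ≢ zero → leading (suc k) F r zero ≡ 0g
  col≡0 zero    r≢0 = ⊥-elim (r≢0 refl)
  col≡0 (suc r) _   = lower≡0 (suc (toℕ r)) 0 (s≤s z≤n)

-- pathPoly k (x + x⁻¹) = (xᵏ⁺¹ − x⁻ᵏ⁻¹) / (x − x⁻¹), the characteristic polynomial of the k-vertex path.
pathPoly : ℕ → ℤ[i] → ℤ[i]
pathPoly zero                T = 1g
pathPoly (suc zero)          T = T
pathPoly (suc (suc k))       T = (T *g pathPoly (suc k) T) -g pathPoly k T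

-- F = T·I − A for a weighted one-way infinite path 0 – 1 – 2 – ⋯ with A(x, x+1)·A(x+1, x) = 1.
record IsPathMatrix (T : ℤ[i]) (F : ℕ → ℕ → ℤ[i]) : Set where
  field
    diagonal    : ∀ x → F x x ≡ T
    offDiagonal : ∀ x → (F x (suc x) *g F (suc x) x) ≡ 1g
    upper       : ∀ x y → suc x ℕ.< y → F x y ≡ 0g
    lower       : ∀ x y → suc y ℕ.< x → F x y ≡ 0g

drop₁-isPathMatrix : ∀ {T F} → IsPathMatrix T F → IsPathMatrix T (drop₁ F)
drop₁-isPathMatrix path = record
  { diagonal    = diagonal ∘ suc
  ; offDiagonal = offDiagonal ∘ suc
  ; upper       = λ x y x+1<y → upper (suc x) (suc y) (s≤s x+1<y)
  ; lower       = λ x y y+1<x → lower (suc x) (suc y) (s≤s y+1<x)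
  }
  where open IsPathMatrix path

det-pathMatrix : ∀ k {T F} → IsPathMatrix T F → det (leading k F) ≡ pathPoly k T
det-pathMatrix zero          path = refl
det-pathMatrix (suc zero)    path = trans (+-identityʳ _) (trans (*-identityʳ _) (IsPathMatrix.diagonal path 0))
det-pathMatrix (suc (suc k)) {T} {F} path = begin
  det (leading (suc (suc k)) F)
    ≡⟨ cong₂ _+g_ (cong₂ _*g_ (diagonal 0) (det-pathMatrix (suc k) (drop₁-isPathMatrix path)))
                  (cong₂ _+g_ (cong (λ d → -g (F 0 1 *g d)) minor₀₁)
                              (sum-zero {f = λ y → expansion M (suc (suc y))} λ y →
                                signed-0* (toℕ (suc (suc y))) (det (minor M zero (suc (suc y))))
                                          (upper 0 (suc (suc (toℕ y))) (s≤s (s≤s z≤n))))) ⟩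
  (T *g pathPoly (suc k) T) +g ((-g (F 0 1 *g (F 1 0 *g pathPoly k T))) +g 0g)
    ≡⟨ cong (λ u → (T *g pathPoly (suc k) T) +g ((-g u) +g 0g))
            (trans (sym (*-assoc (F 0 1) (F 1 0) (pathPoly k T)))
                   (trans (cong (_*g pathPoly k T) (offDiagonal 0)) (*-identityˡ (pathPoly k T)))) ⟩
  (T *g pathPoly (suc k) T) +g ((-g pathPoly k T) +g 0g)
    ≡⟨ cong ((T *g pathPoly (suc k) T) +g_) (+-identityʳ (-g pathPoly k T)) ⟩
  pathPoly (suc (suc k)) T ∎
  where
  open ≡-Reasoning
  open IsPathMatrix path
  M : Matrix (suc (suc k))
  M = leading (suc (suc k)) F
  minor₀₁ : det (minor M zero (suc zero)) ≡ (F 1 0 *g pathPoly k T)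
  minor₀₁ = trans (det-sparseFirstColumn (minor M zero (suc zero)) zero col≡0)
                  (cong (F 1 0 *g_) (det-pathMatrix k (drop₁-isPathMatrix (drop₁-isPathMatrix path))))
    where
    col≡0 : ∀ r → r ≢ zero → minor M zero (suc zero) r zero ≡ 0g
    col≡0 zero    r≢0 = ⊥-elim (r≢0 refl)
    col≡0 (suc r) _   = lower (suc (suc (toℕ r))) 0 (s≤s (s≤s z≤n))

toℕ-punchIn-fromℕ : ∀ {n} (c : Fin n) → toℕ (punchIn (fromℕ n) c) ≡ toℕ c
toℕ-punchIn-fromℕ zero    = refl
toℕ-punchIn-fromℕ (suc c) = cong suc (toℕ-punchIn-fromℕ c)

≢fromℕ⇒toℕ< : ∀ {n} (r : Fin (suc n)) → r ≢ fromℕ n → toℕ r ℕ.< n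
≢fromℕ⇒toℕ< {zero}  zero    r≢n = ⊥-elim (r≢n refl)
≢fromℕ⇒toℕ< {suc n} zero    _   = s≤s z≤n
≢fromℕ⇒toℕ< {suc n} (suc r) r≢n = s≤s (≢fromℕ⇒toℕ< r (r≢n ∘ cong suc))

-- The product of F along the closed walk 0 → 1 → ⋯ → m → 0, on m + 1 vertices.
cycleProduct : ℕ → (ℕ → ℕ → ℤ[i]) → ℤ[i]
cycleProduct m F = ∏ m (λ x → F x (suc x)) *g F m 0

-- Expand along row 0; the minors at columns 1 and m − 1 have first columns supported on their first
-- and last rows, and what remains are path and triangular matrices.
module CycleMatrix (k : ℕ) {T : ℤ[i]} {F : ℕ → ℕ → ℤ[i]}
  (F₀₀≡T : F 0 0 ≡ T) (path : IsPathMatrix T (drop₁ F))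
  (row₀≡0 : ∀ y → 1 ℕ.< y → y ℕ.< suc (suc k) → F 0 y ≡ 0g)
  (col₀≡0 : ∀ x → 1 ℕ.< x → x ℕ.< suc (suc k) → F x 0 ≡ 0g) where

  open IsPathMatrix path using (upper; lower)
  open ≡-Reasoning

  private
    c : ℕ
    c = suc (suc k)
    M : Matrix (suc c)
    M = leading (suc c) F
    p₁ p₂ X Y σ : ℤ[i]
    p₁ = pathPoly (suc k) T
    p₂ = pathPoly c T
    X = ∏ (suc k) (λ x → F (suc x) (suc (suc x)))
    Y = ∏ (suc k) (λ x → F (suc (suc x)) (suc x))
    σ = sign (suc k)

  det-row₀ : det M ≡ ((F 0 0 *g det (minor M zero zero)) +g
                       ((-g (F 0 1 *g det (minor M zero (suc zero)))) +g
                        signed c (F 0 c *g det (minor M zero (fromℕ (suc (suc k)))))))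
  det-row₀ = cong ((F 0 0 *g det (minor M zero zero)) +g_) (cong ((-g (F 0 1 *g det (minor M zero (suc zero)))) +g_) (begin
    sum (λ y → expansion M (suc (suc y)))
      ≡⟨ sum-init-last (λ y → expansion M (suc (suc y))) ⟩
    sum (λ y → expansion M (suc (suc (inject₁ y)))) +g expansion M (fromℕ (suc (suc k)))
      ≡⟨ cong₂ _+g_ (sum-zero {f = λ y → expansion M (suc (suc (inject₁ y)))} middle≡0)
                    (cong (λ n → signed n (F 0 n *g det (minor M zero (fromℕ (suc (suc k))))))
                          (toℕ-fromℕ (suc (suc k)))) ⟩
    0g +g signed c (F 0 c *g det (minor M zero (fromℕ (suc (suc k)))))
      ≡⟨ +-identityˡ _ ⟩
    signed c (F 0 c *g det (minor M zero (fromℕ (suc (suc k))))) ∎))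
    where
    middle≡0 : ∀ y → expansion M (suc (suc (inject₁ y))) ≡ 0g
    middle≡0 y = signed-0* (toℕ (suc (suc (inject₁ y)))) (det (minor M zero (suc (suc (inject₁ y)))))
      (row₀≡0 (suc (suc (toℕ (inject₁ y)))) (s≤s (s≤s z≤n))
              (s≤s (s≤s (subst (ℕ._< k) (sym (toℕ-inject₁ y)) (toℕ<n y)))))

  private
    col₀-sparse : ∀ (r : Fin (suc (suc k))) → r ≢ zero → r ≢ fromℕ (suc k) → F (suc (toℕ r)) 0 ≡ 0g
    col₀-sparse zero    r≢0 _      = ⊥-elim (r≢0 refl)
    col₀-sparse (suc r) _   r≢last =
      col₀≡0 (suc (suc (toℕ r))) (s≤s (s≤s z≤n)) (s≤s (s≤s (≢fromℕ⇒toℕ< r (r≢last ∘ cong suc))))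

  det-minor₀₁ : det (minor M zero (suc zero)) ≡ ((F 1 0 *g p₁) +g signed (suc k) (F c 0 *g X))
  det-minor₀₁ = trans (det-twoEntryFirstColumn (minor M zero (suc zero)) col₀-sparse)
    (cong₂ _+g_ (cong (F 1 0 *g_) (det-pathMatrix (suc k) (drop₁-isPathMatrix path)))
                (cong₂ (λ n d → signed (suc k) (F (suc n) 0 *g d)) (toℕ-fromℕ (suc k)) (trans
                  (det-cong {B = leading (suc k) (λ x y → F (suc x) (suc (suc y)))} λ r c →
                    cong (λ n → F (suc n) (suc (suc (toℕ c)))) (toℕ-punchIn-fromℕ r))
                  (det-lowerTriangular (suc k) (λ x y → F (suc x) (suc (suc y))) λ x y x<y → upper x (suc y) (s≤s x<y)))))

  det-minor₀last : det (minor M zero (fromℕ (suc (suc k)))) ≡ ((F 1 0 *g Y) +g signed (suc k) (F c 0 *g p₁))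
  det-minor₀last =
    trans (det-cong {B = leading (suc (suc k)) (λ x y → F (suc x) y)} λ r c → cong (F (suc (toℕ r))) (toℕ-punchIn-fromℕ c))
    (trans (det-twoEntryFirstColumn (leading (suc (suc k)) (λ x y → F (suc x) y)) col₀-sparse)
      (cong₂ _+g_
        (cong (F 1 0 *g_) (det-upperTriangular (suc k) (λ x y → F (suc (suc x)) (suc y)) λ x y y<x →
                             lower (suc x) y (s≤s y<x)))
        (cong₂ (λ n d → signed (suc k) (F (suc n) 0 *g d)) (toℕ-fromℕ (suc k)) (trans
          (det-cong {B = leading (suc k) (drop₁ F)} λ r c → cong (λ n → F (suc n) (suc (toℕ c))) (toℕ-punchIn-fromℕ r))
          (det-pathMatrix (suc k) path)))))

  det-cycleMatrix : det M ≡
    (((T *g p₂) -g (((F 0 1 *g F 1 0) +g (F 0 c *g F c 0)) *g p₁))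
       -g signed (suc c) (cycleProduct c F +g cycleProduct c (flip F)))
  det-cycleMatrix = begin
    det M
      ≡⟨ det-row₀ ⟩
    ((F 0 0 *g det (minor M zero zero)) +g
       ((-g (F 0 1 *g det (minor M zero (suc zero)))) +g signed c (F 0 c *g det (minor M zero (fromℕ (suc (suc k)))))))
      ≡⟨ cong₂ _+g_ (cong₂ _*g_ F₀₀≡T (det-pathMatrix (suc (suc k)) path))
                    (cong₂ _+g_ (cong (λ d → -g (F 0 1 *g d)) det-minor₀₁)
                                (cong (λ d → signed c (F 0 c *g d)) det-minor₀last)) ⟩
    ((T *g p₂) +g ((-g (F 0 1 *g ((F 1 0 *g p₁) +g signed (suc k) (F c 0 *g X)))) +g
       signed c (F 0 c *g ((F 1 0 *g Y) +g signed (suc k) (F c 0 *g p₁)))))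
      ≡⟨ cong₂ (λ s t → ((T *g p₂) +g ((-g (F 0 1 *g ((F 1 0 *g p₁) +g s))) +g t)))
               (signed≡sign* (suc k) (F c 0 *g X))
               (trans (signed≡sign* c _)
                      (cong₂ (λ s t → s *g (F 0 c *g ((F 1 0 *g Y) +g t)))
                             (sign-suc (suc k)) (signed≡sign* (suc k) (F c 0 *g p₁)))) ⟩
    ((T *g p₂) +g ((-g (F 0 1 *g ((F 1 0 *g p₁) +g (σ *g (F c 0 *g X))))) +g
       ((-g σ) *g (F 0 c *g ((F 1 0 *g Y) +g (σ *g (F c 0 *g p₁)))))))
      ≡⟨ collect σ (F 0 1) (F 1 0) (F 0 c) (F c 0) X Y T p₁ p₂ ⟩
    (((T *g p₂) -g (((F 0 1 *g F 1 0) +g ((σ *g σ) *g (F 0 c *g F c 0))) *g p₁))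
       -g (σ *g (((F 0 1 *g X) *g F c 0) +g ((F 1 0 *g Y) *g F 0 c))))
      ≡⟨ cong₂ (λ s t → ((T *g p₂) -g (((F 0 1 *g F 1 0) +g s) *g p₁)) -g t)
               (trans (cong (_*g (F 0 c *g F c 0)) (sign-square (suc k))) (*-identityˡ (F 0 c *g F c 0)))
               (sym (signed≡sign* (suc k) _)) ⟩
    (((T *g p₂) -g (((F 0 1 *g F 1 0) +g (F 0 c *g F c 0)) *g p₁))
       -g signed (suc c) (cycleProduct c F +g cycleProduct c (flip F))) ∎
    where
    collect : ∀ σ a a' b b' X Y T p₁ p₂ →
      ((T *g p₂) +g ((-g (a *g ((a' *g p₁) +g (σ *g (b' *g X))))) +g ((-g σ) *g (b *g ((a' *g Y) +g (σ *g (b' *g p₁)))))))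
        ≡ (((T *g p₂) -g (((a *g a') +g ((σ *g σ) *g (b *g b'))) *g p₁)) -g (σ *g (((a *g X) *g b') +g ((a' *g Y) *g b))))
    collect σ a a' b b' X Y T p₁ p₂ = Solver.solve (σ ∷ a ∷ a' ∷ b ∷ b' ∷ X ∷ Y ∷ T ∷ p₁ ∷ p₂ ∷ []) ring

open CycleMatrix using (det-cycleMatrix)

two : ℤ[i]
two = 1g +g 1g

-- Vieta–Lucas polynomials: lucas k (x + x⁻¹) = xᵏ + x⁻ᵏ.
lucas : ℕ → ℤ[i] → ℤ[i]
lucas zero                T = two
lucas (suc zero)          T = T
lucas (suc (suc k))       T = (T *g lucas (suc k) T) -g lucas k T

lucas≡pathPoly-pathPoly : ∀ k T → lucas (suc (suc k)) T ≡ (pathPoly (suc (suc k)) T -g pathPoly k T)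
lucas≡pathPoly-pathPoly zero             T = base₂ T
  where
  base₂ : ∀ T → ((T *g T) -g two) ≡ (((T *g T) -g 1g) -g 1g)
  base₂ = Solver.solve-∀ ring
lucas≡pathPoly-pathPoly (suc zero)       T = base₃ T
  where
  base₃ : ∀ T → ((T *g ((T *g T) -g two)) -g T) ≡ (((T *g ((T *g T) -g 1g)) -g T) -g T)
  base₃ = Solver.solve-∀ ring
lucas≡pathPoly-pathPoly (suc (suc k)) T = begin
  (T *g lucas (suc (suc (suc k))) T) -g lucas (suc (suc k)) T
    ≡⟨ cong₂ (λ u v → (T *g u) -g v) (lucas≡pathPoly-pathPoly (suc k) T) (lucas≡pathPoly-pathPoly k T) ⟩
  (T *g (p₃ -g p₁)) -g (p₂ -g p₀)
    ≡⟨ regroup T p₀ p₁ p₂ p₃ ⟩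
  ((T *g p₃) -g p₂) -g ((T *g p₁) -g p₀) ∎
  where
  open ≡-Reasoning
  p₀ p₁ p₂ p₃ : ℤ[i]
  p₀ = pathPoly k T
  p₁ = pathPoly (suc k) T
  p₂ = pathPoly (suc (suc k)) T
  p₃ = pathPoly (suc (suc (suc k))) T
  regroup : ∀ T p₀ p₁ p₂ p₃ → ((T *g (p₃ -g p₁)) -g (p₂ -g p₀)) ≡ (((T *g p₃) -g p₂) -g ((T *g p₁) -g p₀))
  regroup T p₀ p₁ p₂ p₃ = Solver.solve (T ∷ p₀ ∷ p₁ ∷ p₂ ∷ p₃ ∷ []) ring

lucas-product : ∀ b c T → (lucas (b ℕ.+ c) T *g lucas b T) ≡ (lucas (b ℕ.+ (b ℕ.+ c)) T +g lucas c T)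
lucas-product zero          c T = double (lucas c T)
  where
  double : ∀ L → (L *g two) ≡ (L +g L)
  double = Solver.solve-∀ ring
lucas-product (suc zero)    c T = recurrence T (lucas c T) (lucas (suc c) T)
  where
  recurrence : ∀ T L₀ L₁ → (L₁ *g T) ≡ (((T *g L₁) -g L₀) +g L₀)
  recurrence = Solver.solve-∀ ring
lucas-product (suc (suc b)) c T = begin
  lucas (2 ℕ.+ (b ℕ.+ c)) T *g ((T *g lucas (suc b) T) -g lucas b T)
    ≡⟨ distribute T (lucas (2 ℕ.+ (b ℕ.+ c)) T) (lucas (suc b) T) (lucas b T) ⟩
  (T *g (lucas (2 ℕ.+ (b ℕ.+ c)) T *g lucas (suc b) T)) -g (lucas (2 ℕ.+ (b ℕ.+ c)) T *g lucas b T)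
    ≡⟨ cong₂ (λ u v → (T *g (lucas u T *g lucas (suc b) T)) -g (lucas v T *g lucas b T))
             (cong suc (sym (ℕ.+-suc b c))) (sym b+2+c) ⟩
  (T *g (lucas (suc b ℕ.+ suc c) T *g lucas (suc b) T)) -g (lucas (b ℕ.+ (2 ℕ.+ c)) T *g lucas b T)
    ≡⟨ cong₂ (λ u v → (T *g u) -g v) (lucas-product (suc b) (suc c) T) (lucas-product b (2 ℕ.+ c) T) ⟩
  (T *g (lucas (suc b ℕ.+ (suc b ℕ.+ suc c)) T +g lucas (suc c) T))
    -g (lucas (b ℕ.+ (b ℕ.+ (2 ℕ.+ c))) T +g lucas (2 ℕ.+ c) T)
    ≡⟨ cong₂ (λ u v → (T *g (lucas u T +g lucas (suc c) T)) -g (lucas v T +g lucas (2 ℕ.+ c) T))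
             (cong (λ n → suc (b ℕ.+ suc n)) (ℕ.+-suc b c)) (cong (b ℕ.+_) b+2+c) ⟩
  (T *g (lucas (suc N) T +g lucas (suc c) T)) -g (lucas N T +g ((T *g lucas (suc c) T) -g lucas c T))
    ≡⟨ regroup T (lucas (suc N) T) (lucas N T) (lucas (suc c) T) (lucas c T) ⟩
  lucas (suc (suc N)) T +g lucas c T ∎
  where
  open ≡-Reasoning
  N : ℕ
  N = b ℕ.+ (2 ℕ.+ (b ℕ.+ c))
  b+2+c : b ℕ.+ (2 ℕ.+ c) ≡ 2 ℕ.+ (b ℕ.+ c)
  b+2+c = trans (ℕ.+-suc b (suc c)) (cong suc (ℕ.+-suc b c))
  distribute : ∀ T L u v → (L *g ((T *g u) -g v)) ≡ ((T *g (L *g u)) -g (L *g v))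
  distribute T L u v = Solver.solve (T ∷ L ∷ u ∷ v ∷ []) ring
  regroup : ∀ T A B C D → ((T *g (A +g C)) -g (B +g ((T *g C) -g D))) ≡ (((T *g A) -g B) +g D)
  regroup T A B C D = Solver.solve (T ∷ A ∷ B ∷ C ∷ D ∷ []) ring

lucas-square : ∀ n T → (lucas n T *g lucas n T) ≡ (lucas (2 * n) T +g two)
lucas-square n T = trans (cong (λ m → lucas m T *g lucas n T) (sym (ℕ.+-identityʳ n))) (lucas-product n 0 T)

lucas-conjugates : ∀ n T c → ((lucas n T -g c) *g (lucas n T +g c)) ≡ ((lucas (2 * n) T +g two) -g (c *g c))
lucas-conjugates n T c = trans (difference-of-squares (lucas n T) c) (cong (_-g (c *g c)) (lucas-square n T))
  where
  difference-of-squares : ∀ L c → ((L -g c) *g (L +g c)) ≡ ((L *g L) -g (c *g c))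
  difference-of-squares = Solver.solve-∀ ring

⌊⌋-true : ∀ {A : Set} (a? : Dec A) → A → ⌊ a? ⌋ ≡ true
⌊⌋-true a? a = trans (isYes≗does a?) (dec-true a? a)

⌊⌋-false : ∀ {A : Set} (a? : Dec A) → ¬ A → ⌊ a? ⌋ ≡ false
⌊⌋-false a? ¬a = trans (isYes≗does a?) (dec-false a? ¬a)

eqℕ-refl : ∀ x → eqℕ x x ≡ true
eqℕ-refl x = ⌊⌋-true (x ℕ.≟ x) refl

eqℕ-≢ : ∀ {x y} → x ≢ y → eqℕ x y ≡ false
eqℕ-≢ {x} {y} = ⌊⌋-false (x ℕ.≟ y)

Graphℕ : Set
Graphℕ = ℕ → ℕ → Kind

kindℕ : Graphℕ → ℕ → ℕ → Kind
kindℕ G x y with x ℕ.<? y | y ℕ.<? x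
... | yes _ | _     = G x y
... | no _  | yes _ = flipK (G y x)
... | no _  | no _  = none

kindℕ-< : ∀ G {x y} → x ℕ.< y → kindℕ G x y ≡ G x y
kindℕ-< G {x} {y} x<y with x ℕ.<? y
... | yes _   = refl
... | no x≮y  = ⊥-elim (x≮y x<y)

kindℕ-> : ∀ G {x y} → y ℕ.< x → kindℕ G x y ≡ flipK (G y x)
kindℕ-> G {x} {y} y<x with x ℕ.<? y | y ℕ.<? x
... | yes x<y | _      = ⊥-elim (ℕ.<-asym x<y y<x)
... | no _    | yes _  = refl
... | no _    | no y≮x = ⊥-elim (y≮x y<x)

kindℕ-refl : ∀ G x → kindℕ G x x ≡ none
kindℕ-refl G x with x ℕ.<? x
... | yes x<x = ⊥-elim (ℕ.<-irrefl refl x<x)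
... | no _    = refl

restrict : ∀ {m} → Graphℕ → MixedGraph m
restrict G r c = G (toℕ r) (toℕ c)

-- `Fin._<?_` unfolds to this comparison of `toℕ`s, so `kind` and `kindℕ` take the same branch.
kind-restrict : ∀ {m} G (r c : Fin m) → kind (restrict G) r c ≡ kindℕ G (toℕ r) (toℕ c)
kind-restrict G r c with suc (toℕ r) ℕ.≤? toℕ c | suc (toℕ c) ℕ.≤? toℕ r
... | yes _ | _     = refl
... | no _  | yes _ = refl
... | no _  | no _  = refl

charMatrixℕ : ℤ → Graphℕ → ℕ → ℕ → ℤ[i]
charMatrixℕ t G x y = (if eqℕ x y then fromℤ t else 0g) -g entry (kindℕ G x y)

charMatrixℕ-diag : ∀ t G x → charMatrixℕ t G x x ≡ fromℤ t
charMatrixℕ-diag t G x =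
  trans (cong₂ (λ b κ → (if b then fromℤ t else 0g) -g entry κ) (eqℕ-refl x) (kindℕ-refl G x))
        (+-identityʳ (fromℤ t))

charMatrixℕ-< : ∀ t G {x y} → x ℕ.< y → charMatrixℕ t G x y ≡ -g entry (G x y)
charMatrixℕ-< t G {x} {y} x<y =
  trans (cong₂ (λ b κ → (if b then fromℤ t else 0g) -g entry κ) (eqℕ-≢ (ℕ.<⇒≢ x<y)) (kindℕ-< G x<y))
        (+-identityˡ (-g entry (G x y)))

charMatrixℕ-> : ∀ t G {x y} → y ℕ.< x → charMatrixℕ t G x y ≡ -g entry (flipK (G y x))
charMatrixℕ-> t G {x} {y} y<x =
  trans (cong₂ (λ b κ → (if b then fromℤ t else 0g) -g entry κ) (eqℕ-≢ (ℕ.>⇒≢ y<x)) (kindℕ-> G y<x))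
        (+-identityˡ (-g entry (flipK (G y x))))

χ : ∀ {n} → MixedGraph n → ℤ → ℤ[i]
χ X t = det (shift t (H X))

≟-eqℕ : ∀ {m} (r c : Fin m) → ⌊ r Fin.≟ c ⌋ ≡ eqℕ (toℕ r) (toℕ c)
≟-eqℕ r c with r Fin.≟ c
... | yes refl = sym (eqℕ-refl (toℕ r))
... | no r≢c   = sym (eqℕ-≢ (r≢c ∘ toℕ-injective))

χ-restrict : ∀ m G t → χ (restrict {m} G) t ≡ det (leading m (charMatrixℕ t G))
χ-restrict m G t = det-cong {m} λ r c →
  cong₂ (λ b κ → (if b then fromℤ t else 0g) -g entry κ) (≟-eqℕ r c) (kind-restrict G r c)

kind-cong : ∀ {m} {X Y : MixedGraph m} → (∀ j k → X j k ≡ Y j k) → ∀ r c → kind X r c ≡ kind Y r c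
kind-cong X≗Y r c with r Fin.<? c | c Fin.<? r
... | yes _ | _     = X≗Y r c
... | no _  | yes _ = cong flipK (X≗Y c r)
... | no _  | no _  = refl

χ-cong : ∀ {m} {X Y : MixedGraph m} → (∀ j k → X j k ≡ Y j k) → ∀ t → χ X t ≡ χ Y t
χ-cong {m} X≗Y t = det-cong {m} λ r c →
  cong (λ κ → (if ⌊ r Fin.≟ c ⌋ then fromℤ t else 0g) -g entry κ) (kind-cong X≗Y r c)

cycleWith : ℕ → Kind → Kind → Graphℕ
cycleWith m a b 0       1 = a
cycleWith m a b 1       2 = b
cycleWith m a b 0       y = if eqℕ y (m ∸ 1) then und else none
cycleWith m a b (suc x) y = if eqℕ y (suc (suc x)) then und else none

cycleWith-step : ∀ m a b x → cycleWith m a b (suc (suc x)) (suc (suc (suc x))) ≡ und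
cycleWith-step m a b x = cong (λ β → if β then und else none) (eqℕ-refl (suc (suc (suc x))))

cycleWith-next : ∀ m a b → a ≢ none → b ≢ none → ∀ x → cycleWith m a b x (suc x) ≢ none
cycleWith-next m a b a≢none b≢none zero             = a≢none
cycleWith-next m a b a≢none b≢none (suc zero)       = b≢none
cycleWith-next m a b a≢none b≢none (suc (suc x)) eq with trans (sym (cycleWith-step m a b x)) eq
... | ()

cycleWith-far : ∀ m a b x y → suc (suc x) ℕ.< y → cycleWith m a b (suc x) y ≡ none
cycleWith-far m a b zero    y x+2<y@(s≤s (s≤s (s≤s _))) = cong (λ β → if β then und else none) (eqℕ-≢ (ℕ.>⇒≢ x+2<y))
cycleWith-far m a b (suc x) y x+2<y                     = cong (λ β → if β then und else none) (eqℕ-≢ (ℕ.>⇒≢ x+2<y))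

cycleWith-row₀ : ∀ k a b y → 1 ℕ.< y → y ℕ.< suc (suc k) → cycleWith (suc (suc (suc k))) a b 0 y ≡ none
cycleWith-row₀ k a b y (s≤s (s≤s _)) y<k+2 = cong (λ β → if β then und else none) (eqℕ-≢ (ℕ.<⇒≢ y<k+2))

cycleWith-corner : ∀ k a b → cycleWith (suc (suc (suc k))) a b 0 (suc (suc k)) ≡ und
cycleWith-corner k a b = cong (λ β → if β then und else none) (eqℕ-refl (suc (suc k)))

entry-flipK-inverse : ∀ {κ} → κ ≢ none → ((-g entry κ) *g (-g entry (flipK κ))) ≡ 1g
entry-flipK-inverse {none} κ≢none = ⊥-elim (κ≢none refl)
entry-flipK-inverse {und}  _      = refl
entry-flipK-inverse {fwd}  _      = refl
entry-flipK-inverse {bwd}  _      = refl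

∏-cong : ∀ k {f g : ℕ → ℤ[i]} → (∀ x → f x ≡ g x) → ∏ k f ≡ ∏ k g
∏-cong zero    f≗g = refl
∏-cong (suc k) f≗g = cong₂ _*g_ (f≗g 0) (∏-cong k (f≗g ∘ suc))

∏-negOne : ∀ k → ∏ k (λ _ → -g 1g) ≡ sign k
∏-negOne zero    = refl
∏-negOne (suc k) = begin
  (-g 1g) *g ∏ k (λ _ → -g 1g) ≡⟨ cong ((-g 1g) *g_) (∏-negOne k) ⟩
  (-g 1g) *g sign k            ≡⟨ negate (sign k) ⟩
  -g sign k                    ≡⟨ sym (sign-suc k) ⟩
  sign (suc k)                 ∎
  where
  open ≡-Reasoning
  negate : ∀ s → ((-g 1g) *g s) ≡ (-g s)
  negate s = Solver.solve (s ∷ []) ring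

cycleProduct-negated : ∀ k (F : ℕ → ℕ → ℤ[i]) u v → F 0 1 ≡ -g u → F 1 2 ≡ -g v →
  (∀ x → F (suc (suc x)) (suc (suc (suc x))) ≡ -g 1g) → F (suc (suc k)) 0 ≡ -g 1g →
  cycleProduct (suc (suc k)) F ≡ signed (suc k) (u *g v)
cycleProduct-negated k F u v F₀₁ F₁₂ F-step F-corner = begin
  (F 0 1 *g (F 1 2 *g ∏ k (λ x → F (suc (suc x)) (suc (suc (suc x)))))) *g F (suc (suc k)) 0
    ≡⟨ cong₂ _*g_ (cong₂ _*g_ F₀₁ (cong₂ _*g_ F₁₂ (trans (∏-cong k F-step) (∏-negOne k)))) F-corner ⟩
  ((-g u) *g ((-g v) *g sign k)) *g (-g 1g)
    ≡⟨ collect u v (sign k) ⟩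
  (-g sign k) *g (u *g v)
    ≡⟨ sym (trans (signed≡sign* (suc k) (u *g v)) (cong (_*g (u *g v)) (sign-suc k))) ⟩
  signed (suc k) (u *g v) ∎
  where
  open ≡-Reasoning
  collect : ∀ u v s → (((-g u) *g ((-g v) *g s)) *g (-g 1g)) ≡ ((-g s) *g (u *g v))
  collect u v s = Solver.solve (u ∷ v ∷ s ∷ []) ring

module CycleWith (k : ℕ) (a b : Kind) (t : ℤ) (a≢none : a ≢ none) (b≢none : b ≢ none) where

  private
    m c : ℕ
    m = suc (suc (suc k))
    c = suc (suc k)
    G : Graphℕ
    G = cycleWith m a b
    F : ℕ → ℕ → ℤ[i]
    F = charMatrixℕ t G
    T : ℤ[i]
    T = fromℤ t

  edge-product : ∀ x → (F x (suc x) *g F (suc x) x) ≡ 1g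
  edge-product x = trans (cong₂ _*g_ (charMatrixℕ-< t G (ℕ.n<1+n x)) (charMatrixℕ-> t G (ℕ.n<1+n x)))
                         (entry-flipK-inverse (cycleWith-next m a b a≢none b≢none x))

  corner-product : (F 0 c *g F c 0) ≡ 1g
  corner-product = trans (cong₂ _*g_ (charMatrixℕ-< t G {0} {c} (s≤s z≤n)) (charMatrixℕ-> t G {c} {0} (s≤s z≤n)))
                         (cong (λ κ → (-g entry κ) *g (-g entry (flipK κ))) (cycleWith-corner k a b))

  isPathMatrix : IsPathMatrix T (drop₁ F)
  isPathMatrix = record
    { diagonal    = λ x → charMatrixℕ-diag t G (suc x)
    ; offDiagonal = λ x → edge-product (suc x)
    ; upper       = λ x y x+1<y → trans (charMatrixℕ-< t G (ℕ.<-trans (ℕ.n<1+n (suc x)) (s≤s x+1<y)))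
                                        (cong (λ κ → -g entry κ) (cycleWith-far m a b x (suc y) (s≤s x+1<y)))
    ; lower       = λ x y y+1<x → trans (charMatrixℕ-> t G (ℕ.<-trans (ℕ.n<1+n (suc y)) (s≤s y+1<x)))
                                        (cong (λ κ → -g entry (flipK κ)) (cycleWith-far m a b y (suc x) (s≤s y+1<x)))
    }

  row₀≡0 : ∀ y → 1 ℕ.< y → y ℕ.< c → F 0 y ≡ 0g
  row₀≡0 y 1<y y<c = trans (charMatrixℕ-< t G (ℕ.<-trans (s≤s z≤n) 1<y))
                           (cong (λ κ → -g entry κ) (cycleWith-row₀ k a b y 1<y y<c))

  col₀≡0 : ∀ x → 1 ℕ.< x → x ℕ.< c → F x 0 ≡ 0g
  col₀≡0 x 1<x x<c = trans (charMatrixℕ-> t G (ℕ.<-trans (s≤s z≤n) 1<x))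
                           (cong (λ κ → -g entry (flipK κ)) (cycleWith-row₀ k a b x 1<x x<c))

  cycleProduct-forward : cycleProduct c F ≡ signed (suc k) (entry a *g entry b)
  cycleProduct-forward = cycleProduct-negated k F (entry a) (entry b)
    (charMatrixℕ-< t G {0} {1} (s≤s z≤n)) (charMatrixℕ-< t G {1} {2} (s≤s (s≤s z≤n)))
    (λ x → trans (charMatrixℕ-< t G (ℕ.n<1+n (suc (suc x)))) (cong (λ κ → -g entry κ) (cycleWith-step m a b x)))
    (trans (charMatrixℕ-> t G {c} {0} (s≤s z≤n)) (cong (λ κ → -g entry (flipK κ)) (cycleWith-corner k a b)))

  cycleProduct-backward : cycleProduct c (flip F) ≡ signed (suc k) (entry (flipK a) *g entry (flipK b))
  cycleProduct-backward = cycleProduct-negated k (flip F) (entry (flipK a)) (entry (flipK b))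
    (charMatrixℕ-> t G {1} {0} (s≤s z≤n)) (charMatrixℕ-> t G {2} {1} (s≤s (s≤s z≤n)))
    (λ x → trans (charMatrixℕ-> t G (ℕ.n<1+n (suc (suc x)))) (cong (λ κ → -g entry (flipK κ)) (cycleWith-step m a b x)))
    (trans (charMatrixℕ-< t G {0} {c} (s≤s z≤n)) (cong (λ κ → -g entry κ) (cycleWith-corner k a b)))

  det-charMatrix : det (leading m F) ≡ (lucas m T -g ((entry a *g entry b) +g (entry (flipK a) *g entry (flipK b))))
  det-charMatrix = begin
    det (leading m F)
      ≡⟨ det-cycleMatrix k {T} {F} (charMatrixℕ-diag t G 0) isPathMatrix row₀≡0 col₀≡0 ⟩
    ((T *g p₂) -g (((F 0 1 *g F 1 0) +g (F 0 c *g F c 0)) *g p₁)) -g signed m (cycleProduct c F +g cycleProduct c (flip F))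
      ≡⟨ cong₂ (λ u v → ((T *g p₂) -g ((u +g v) *g p₁)) -g signed m (cycleProduct c F +g cycleProduct c (flip F)))
               (edge-product 0) corner-product ⟩
    ((T *g p₂) -g ((1g +g 1g) *g p₁)) -g signed m (cycleProduct c F +g cycleProduct c (flip F))
      ≡⟨ cong₂ _-g_ (trans (recurrence T p₁ p₂) (sym (lucas≡pathPoly-pathPoly (suc k) T)))
                    (trans (cong (signed (suc k)) (cong₂ _+g_ cycleProduct-forward cycleProduct-backward))
                           (trans (signed-+ (suc k) (signed (suc k) ab) (signed (suc k) ab'))
                                  (cong₂ _+g_ (signed-involutive (suc k) ab) (signed-involutive (suc k) ab')))) ⟩
    lucas m T -g (ab +g ab') ∎
    where
    open ≡-Reasoning
    ab ab' : ℤ[i]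
    ab = entry a *g entry b
    ab' = entry (flipK a) *g entry (flipK b)
    p₁ p₂ : ℤ[i]
    p₁ = pathPoly (suc k) T
    p₂ = pathPoly (suc (suc k)) T
    recurrence : ∀ T p₁ p₂ → ((T *g p₂) -g ((1g +g 1g) *g p₁)) ≡ (((T *g p₂) -g p₁) -g p₁)
    recurrence T p₁ p₂ = Solver.solve (T ∷ p₁ ∷ p₂ ∷ []) ring

-- Stated for an arbitrary order m, so that instances at order 2 * n match syntactically:
-- comparing suc (suc (suc k)) with 2 * n would make Agda unfold `det`.
χ-cycleWith : ∀ m a b t → 3 ≤ m → a ≢ none → b ≢ none →
  det (leading m (charMatrixℕ t (cycleWith m a b))) ≡
    (lucas m (fromℤ t) -g ((entry a *g entry b) +g (entry (flipK a) *g entry (flipK b))))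
χ-cycleWith .(suc (suc (suc k))) a b t (s≤s (s≤s (s≤s {n = k} _))) = CycleWith.det-charMatrix k a b t

χ-restrict-cycleWith : ∀ m a b t → 3 ≤ m → a ≢ none → b ≢ none →
  χ (restrict {m} (cycleWith m a b)) t ≡
    (lucas m (fromℤ t) -g ((entry a *g entry b) +g (entry (flipK a) *g entry (flipK b))))
χ-restrict-cycleWith m a b t 3≤m a≢none b≢none =
  trans (χ-restrict m (cycleWith m a b) t) (χ-cycleWith m a b t 3≤m a≢none b≢none)

union : ℕ → Graphℕ → Graphℕ → Graphℕ
union n P Q x y =
  if ⌊ x ℕ.<? n ⌋ then (if ⌊ y ℕ.<? n ⌋ then P x y else none)
                  else (if ⌊ y ℕ.<? n ⌋ then none else Q (x ∸ n) (y ∸ n))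

union-top : ∀ n P Q {x y} → x ℕ.< n → y ℕ.< n → union n P Q x y ≡ P x y
union-top n P Q {x} {y} x<n y<n rewrite ⌊⌋-true (x ℕ.<? n) x<n | ⌊⌋-true (y ℕ.<? n) y<n = refl

union-across : ∀ n P Q {x y} → x ℕ.< n → n ℕ.≤ y → union n P Q x y ≡ none
union-across n P Q {x} {y} x<n n≤y
  rewrite ⌊⌋-true (x ℕ.<? n) x<n | ⌊⌋-false (y ℕ.<? n) (ℕ.≤⇒≯ n≤y) = refl

union-bottom : ∀ n P Q x y → union n P Q (n ℕ.+ x) (n ℕ.+ y) ≡ Q x y
union-bottom n P Q x y
  rewrite ⌊⌋-false ((n ℕ.+ x) ℕ.<? n) (ℕ.≤⇒≯ (ℕ.m≤m+n n x))
        | ⌊⌋-false ((n ℕ.+ y) ℕ.<? n) (ℕ.≤⇒≯ (ℕ.m≤m+n n y))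
        | ℕ.m+n∸m≡n n x | ℕ.m+n∸m≡n n y = refl

union-separated : ∀ n P Q x y → union n P Q x y ≢ none → ⌊ x ℕ.<? n ⌋ ≡ ⌊ y ℕ.<? n ⌋
union-separated n P Q x y edge with ⌊ x ℕ.<? n ⌋ | ⌊ y ℕ.<? n ⌋
... | true  | true  = refl
... | false | false = refl
... | true  | false = ⊥-elim (edge refl)
... | false | true  = ⊥-elim (edge refl)

charMatrixℕ-reindex : ∀ t G G' (f : ℕ → ℕ) → (∀ {x y} → x ℕ.< y → f x ℕ.< f y) → ∀ x y →
  (x ℕ.< y → G (f x) (f y) ≡ G' x y) → (y ℕ.< x → G (f y) (f x) ≡ G' y x) →
  charMatrixℕ t G (f x) (f y) ≡ charMatrixℕ t G' x y
charMatrixℕ-reindex t G G' f f-mono x y G≡G'₁ G≡G'₂ with ℕ.<-cmp x y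
... | tri< x<y _ _ = trans (charMatrixℕ-< t G (f-mono x<y))
                           (trans (cong (λ κ → -g entry κ) (G≡G'₁ x<y)) (sym (charMatrixℕ-< t G' x<y)))
... | tri≈ _ refl _ = trans (charMatrixℕ-diag t G (f x)) (sym (charMatrixℕ-diag t G' x))
... | tri> _ _ y<x = trans (charMatrixℕ-> t G (f-mono y<x))
                           (trans (cong (λ κ → -g entry (flipK κ)) (G≡G'₂ y<x)) (sym (charMatrixℕ-> t G' y<x)))

χ-union : ∀ n n' P Q t →
  χ (restrict {n ℕ.+ n'} (union n P Q)) t ≡
    (det (leading n (charMatrixℕ t P)) *g det (leading n' (charMatrixℕ t Q)))
χ-union n n' P Q t =
  trans (χ-restrict (n ℕ.+ n') U t)
    (trans (det-blockTriangular n n' (leading (n ℕ.+ n') (charMatrixℕ t U)) across≡0)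
           (cong₂ _*g_ (det-cong {n} top) (det-cong {n'} bottom)))
  where
  U : Graphℕ
  U = union n P Q
  across≡0 : ∀ r c → charMatrixℕ t U (toℕ (r ↑ˡ n')) (toℕ (n ↑ʳ c)) ≡ 0g
  across≡0 r c rewrite toℕ-↑ˡ r n' | toℕ-↑ʳ n c =
    trans (charMatrixℕ-< t U (ℕ.<-≤-trans (toℕ<n r) (ℕ.m≤m+n n (toℕ c))))
          (cong (λ κ → -g entry κ) (union-across n P Q (toℕ<n r) (ℕ.m≤m+n n (toℕ c))))
  top : ∀ r c → charMatrixℕ t U (toℕ (r ↑ˡ n')) (toℕ (c ↑ˡ n')) ≡ charMatrixℕ t P (toℕ r) (toℕ c)
  top r c rewrite toℕ-↑ˡ r n' | toℕ-↑ˡ c n' =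
    charMatrixℕ-reindex t U P (λ x → x) (λ x<y → x<y) (toℕ r) (toℕ c)
      (λ _ → union-top n P Q (toℕ<n r) (toℕ<n c)) (λ _ → union-top n P Q (toℕ<n c) (toℕ<n r))
  bottom : ∀ r c → charMatrixℕ t U (toℕ (n ↑ʳ r)) (toℕ (n ↑ʳ c)) ≡ charMatrixℕ t Q (toℕ r) (toℕ c)
  bottom r c rewrite toℕ-↑ʳ n r | toℕ-↑ʳ n c =
    charMatrixℕ-reindex t U Q (n ℕ.+_) (ℕ.+-monoʳ-< n) (toℕ r) (toℕ c)
      (λ _ → union-bottom n P Q (toℕ r) (toℕ c)) (λ _ → union-bottom n P Q (toℕ c) (toℕ r))

χ-union-halves : ∀ n P Q t →
  χ (restrict {2 * n} (union n P Q)) t ≡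
    (det (leading n (charMatrixℕ t P)) *g det (leading n (charMatrixℕ t Q)))
χ-union-halves n P Q t =
  trans (χ-union n (n ℕ.+ 0) P Q t)
        (cong (λ m → det (leading n (charMatrixℕ t P)) *g det (leading m (charMatrixℕ t Q))) (ℕ.+-identityʳ n))

kindℕ-separated : ∀ {A : Set} G (part : ℕ → A) → (∀ x y → G x y ≢ none → part x ≡ part y) →
  ∀ x y → kindℕ G x y ≢ none → part x ≡ part y
kindℕ-separated G part separated x y edge with x ℕ.<? y | y ℕ.<? x
... | yes _ | _     = separated x y edge
... | no _  | yes _ = sym (separated y x λ G≡none → edge (cong flipK G≡none))
... | no _  | no _  = ⊥-elim (edge refl)

constant-along-path : ∀ {m} {A : Set} (f : Fin (suc m) → A) →
  (∀ (r : Fin m) → f (inject₁ r) ≡ f (suc r)) → ∀ v → f v ≡ f zero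
constant-along-path         f step zero    = refl
constant-along-path {suc m} f step (suc r) =
  trans (sym (step r)) (constant-along-path (f ∘ inject₁) (step ∘ inject₁) r)

unit*unitInv : ∀ d → (unit d *g unitInv d) ≡ 1g
unit*unitInv zero                   = refl
unit*unitInv (suc zero)             = refl
unit*unitInv (suc (suc zero))       = refl
unit*unitInv (suc (suc (suc zero))) = refl

entry≡0g⇒none : ∀ κ → entry κ ≡ 0g → κ ≡ none
entry≡0g⇒none none _ = refl
entry≡0g⇒none und  ()
entry≡0g⇒none fwd  ()
entry≡0g⇒none bwd  ()

switching-preserves-nonEdges : ∀ {m} {Y Z : MixedGraph m} → SwitchingEquivalent Y Z →
  ∀ r c → kind Y r c ≡ none → kind Z r c ≡ none
switching-preserves-nonEdges {Y = Y} {Z} (d , H≡DHD) r c Y-none = entry≡0g⇒none (kind Z r c) (begin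
  h                                   ≡⟨ sym (*-identityˡ h) ⟩
  1g *g h                             ≡⟨ cong₂ (λ p q → (p *g q) *g h) (sym (unit*unitInv (d r)))
                                                                      (sym (unit*unitInv (d c))) ⟩
  ((u *g u⁻¹) *g (v *g v⁻¹)) *g h    ≡⟨ regroup u u⁻¹ v v⁻¹ h ⟩
  (u *g ((u⁻¹ *g h) *g v)) *g v⁻¹    ≡⟨ cong (λ x → (u *g x) *g v⁻¹) (sym (H≡DHD r c)) ⟩
  (u *g entry (kind Y r c)) *g v⁻¹   ≡⟨ cong (λ κ → (u *g entry κ) *g v⁻¹) Y-none ⟩
  (u *g 0g) *g v⁻¹                    ≡⟨ trans (cong (_*g v⁻¹) (zeroʳ u)) (zeroˡ v⁻¹) ⟩
  0g                                  ∎)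
  where
  open ≡-Reasoning
  h u u⁻¹ v v⁻¹ : ℤ[i]
  h = H Z r c
  u = unit (d r)
  u⁻¹ = unitInv (d r)
  v = unit (d c)
  v⁻¹ = unitInv (d c)
  regroup : ∀ u u⁻¹ v v⁻¹ h → (((u *g u⁻¹) *g (v *g v⁻¹)) *g h) ≡ ((u *g ((u⁻¹ *g h) *g v)) *g v⁻¹)
  regroup u u⁻¹ v v⁻¹ h = Solver.solve (u ∷ u⁻¹ ∷ v ∷ v⁻¹ ∷ h ∷ []) ring

cospectral-separated⇒¬DHS : ∀ {m} {A : Set} (X Y : MixedGraph (suc m)) (part : Fin (suc m) → A) {r₀ r₁} →
  (∀ (r : Fin m) → kind X (inject₁ r) (suc r) ≢ none) →
  (∀ r c → kind Y r c ≢ none → part r ≡ part c) →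
  part r₀ ≢ part r₁ → Cospectral Y X → ¬ DHS X
cospectral-separated⇒¬DHS X Y part {r₀} {r₁} path separated r₀≁r₁ cospectral dhs with dhs Y cospectral
... | Z , switching , σ , iso = r₀≁r₁ (trans (part-constant r₀) (sym (part-constant r₁)))
  where
  open Inverse σ using (to; from; strictlyInverseˡ; strictlyInverseʳ)
  Y-edge : ∀ u v → kind X u v ≢ none → kind Y (from u) (from v) ≢ none
  Y-edge u v X-edge Y-none = X-edge (begin
    kind X u v                      ≡⟨ sym (cong₂ (kind X) (strictlyInverseˡ u) (strictlyInverseˡ v)) ⟩
    kind X (to (from u)) (to (from v)) ≡⟨ iso (from u) (from v) ⟩
    kind Z (from u) (from v)        ≡⟨ switching-preserves-nonEdges switching (from u) (from v) Y-none ⟩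
    none                            ∎)
    where open ≡-Reasoning
  part-constant : ∀ w → part w ≡ part (from zero)
  part-constant w = trans (cong part (sym (strictlyInverseʳ w)))
    (constant-along-path (part ∘ from) (λ r → separated _ _ (Y-edge (inject₁ r) (suc r) (path r))) (to w))

restrict-traceable : ∀ {m} G → (∀ x → G x (suc x) ≢ none) →
  ∀ (r : Fin m) → kind (restrict {suc m} G) (inject₁ r) (suc r) ≢ none
restrict-traceable G G-path r edge≡none = G-path (toℕ r) (begin
  G (toℕ r) (suc (toℕ r))                  ≡⟨ sym (kindℕ-< G (ℕ.n<1+n (toℕ r))) ⟩
  kindℕ G (toℕ r) (suc (toℕ r))            ≡⟨ cong (λ x → kindℕ G x (suc (toℕ r))) (sym (toℕ-inject₁ r)) ⟩
  kindℕ G (toℕ (inject₁ r)) (toℕ (suc r))  ≡⟨ sym (kind-restrict G (inject₁ r) (suc r)) ⟩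
  kind (restrict G) (inject₁ r) (suc r)    ≡⟨ edge≡none ⟩
  none                                     ∎)
  where open ≡-Reasoning

traceable-cospectral-with-union⇒¬DHS : ∀ n (G P Q : Graphℕ) {X : MixedGraph (2 * n)} → 1 ≤ n →
  (∀ j k → X j k ≡ restrict G j k) → (∀ x → G x (suc x) ≢ none) →
  Cospectral (restrict {2 * n} (union n P Q)) X → ¬ DHS X
traceable-cospectral-with-union⇒¬DHS .(suc n₀) G P Q {X} (s≤s {n = n₀} z≤n) X≗G G-path =
  cospectral-separated⇒¬DHS X (restrict (union n P Q)) part {zero} {n ↑ʳ zero}
    (λ r X-none → restrict-traceable G G-path r (trans (sym (kind-cong X≗G (inject₁ r) (suc r))) X-none))
    (λ r c edge → kindℕ-separated (union n P Q) (λ x → ⌊ x ℕ.<? n ⌋) (union-separated n P Q) (toℕ r) (toℕ c)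
                    (λ κ≡none → edge (trans (kind-restrict (union n P Q) r c) κ≡none)))
    part₀≢part₁
  where
  n : ℕ
  n = suc n₀
  part : Fin (2 * n) → Bool
  part r = ⌊ toℕ r ℕ.<? n ⌋
  part₀≢part₁ : part zero ≢ part (n ↑ʳ zero)
  part₀≢part₁ eq with trans eq (⌊⌋-false (toℕ (n ↑ʳ zero {n₀ ℕ.+ 0}) ℕ.<? n)
                        (ℕ.≤⇒≯ (subst (n ℕ.≤_) (sym (toℕ-↑ʳ n (zero {n₀ ℕ.+ 0}))) (ℕ.m≤m+n n 0))))
  ... | ()

Cyc≗cycleWith : ∀ m j k → Cyc m j k ≡ restrict (cycleWith m und und) j k
Cyc≗cycleWith m j k = adjacency (toℕ j) (toℕ k)
  where
  adjacency : ∀ x y → (if eqℕ y (suc x) ∨ (eqℕ x 0 ∧ eqℕ y (m ∸ 1)) then und else none) ≡ cycleWith m und und x y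
  adjacency zero                zero          = refl
  adjacency zero                (suc zero)    = refl
  adjacency zero                (suc (suc y)) = refl
  adjacency (suc zero)          zero          = refl
  adjacency (suc zero)          (suc zero)    = refl
  adjacency (suc zero)          (suc (suc zero)) = refl
  adjacency (suc zero)          (suc (suc (suc y))) = refl
  adjacency (suc (suc x))       y = cong (λ β → if β then und else none) (∨-identityʳ (eqℕ y (suc (suc (suc x)))))

Cyc2≗cycleWith : ∀ m j k → Cyc2 m j k ≡ restrict (cycleWith m fwd fwd) j k
Cyc2≗cycleWith m j k = adjacency (toℕ j) (toℕ k)
  where
  adjacency : ∀ x y → (if (eqℕ x 0 ∧ eqℕ y 1) ∨ (eqℕ x 1 ∧ eqℕ y 2) then fwd
                       else (if eqℕ y (suc x) ∨ (eqℕ x 0 ∧ eqℕ y (m ∸ 1)) then und else none))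
                      ≡ cycleWith m fwd fwd x y
  adjacency zero          (suc zero)       = refl
  adjacency (suc zero)    (suc (suc zero)) = refl
  adjacency zero          zero             = refl
  adjacency zero          (suc (suc y))    = refl
  adjacency (suc zero)    zero             = refl
  adjacency (suc zero)    (suc zero)       = refl
  adjacency (suc zero)    (suc (suc (suc y))) = refl
  adjacency (suc (suc x)) y = cong (λ β → if β then und else none) (∨-identityʳ (eqℕ y (suc (suc (suc x)))))

Cyc-cospectral-union : ∀ n → 3 ≤ n →
  Cospectral (restrict (union n (cycleWith n und und) (cycleWith n fwd fwd))) (Cyc (2 * n))
Cyc-cospectral-union n 3≤n t = begin
  χ (restrict {2 * n} (union n (cycleWith n und und) (cycleWith n fwd fwd))) t
    ≡⟨ χ-union-halves n (cycleWith n und und) (cycleWith n fwd fwd) t ⟩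
  det (leading n (charMatrixℕ t (cycleWith n und und))) *g det (leading n (charMatrixℕ t (cycleWith n fwd fwd)))
    ≡⟨ cong₂ _*g_ (χ-cycleWith n und und t 3≤n (λ ()) (λ ())) (χ-cycleWith n fwd fwd t 3≤n (λ ()) (λ ())) ⟩
  (lucas n T -g two) *g (lucas n T +g two)      ≡⟨ lucas-conjugates n T two ⟩
  (lucas (2 * n) T +g two) -g (two *g two)      ≡⟨ arithmetic (lucas (2 * n) T) ⟩
  lucas (2 * n) T -g two
    ≡⟨ sym (trans (χ-cong (Cyc≗cycleWith (2 * n)) t) (χ-restrict-cycleWith (2 * n) und und t 3≤2n (λ ()) (λ ()))) ⟩
  χ (Cyc (2 * n)) t ∎
  where
  open ≡-Reasoning
  T : ℤ[i]
  T = fromℤ t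
  3≤2n : 3 ≤ 2 * n
  3≤2n = ℕ.≤-trans 3≤n (ℕ.m≤m+n n (n ℕ.+ 0))
  arithmetic : ∀ L → ((L +g two) -g (two *g two)) ≡ (L -g two)
  arithmetic = Solver.solve-∀ ring

Cyc2-cospectral-union : ∀ n → 3 ≤ n →
  Cospectral (restrict (union n (cycleWith n fwd und) (cycleWith n fwd und))) (Cyc2 (2 * n))
Cyc2-cospectral-union n 3≤n t = begin
  χ (restrict {2 * n} (union n (cycleWith n fwd und) (cycleWith n fwd und))) t
    ≡⟨ χ-union-halves n (cycleWith n fwd und) (cycleWith n fwd und) t ⟩
  det (leading n (charMatrixℕ t (cycleWith n fwd und))) *g det (leading n (charMatrixℕ t (cycleWith n fwd und)))
    ≡⟨ cong₂ _*g_ (χ-cycleWith n fwd und t 3≤n (λ ()) (λ ())) (χ-cycleWith n fwd und t 3≤n (λ ()) (λ ())) ⟩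
  (lucas n T -g 0g) *g (lucas n T +g 0g)        ≡⟨ lucas-conjugates n T 0g ⟩
  (lucas (2 * n) T +g two) -g (0g *g 0g)        ≡⟨ arithmetic (lucas (2 * n) T) ⟩
  lucas (2 * n) T -g (-g two)
    ≡⟨ sym (trans (χ-cong (Cyc2≗cycleWith (2 * n)) t) (χ-restrict-cycleWith (2 * n) fwd fwd t 3≤2n (λ ()) (λ ()))) ⟩
  χ (Cyc2 (2 * n)) t ∎
  where
  open ≡-Reasoning
  T : ℤ[i]
  T = fromℤ t
  3≤2n : 3 ≤ 2 * n
  3≤2n = ℕ.≤-trans 3≤n (ℕ.m≤m+n n (n ℕ.+ 0))
  arithmetic : ∀ L → ((L +g two) -g (0g *g 0g)) ≡ (L -g (-g two))
  arithmetic = Solver.solve-∀ ring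

theorem4p1 : ∀ (n : ℕ) → 3 ≤ n →
    ¬ DHS (Cyc (2 * n)) × ¬ DHS (Cyc2 (2 * n))
theorem4p1 n 3≤n =
    traceable-cospectral-with-union⇒¬DHS n (cycleWith (2 * n) und und)
      (cycleWith n und und) (cycleWith n fwd fwd) 1≤n
      (Cyc≗cycleWith (2 * n)) (cycleWith-next (2 * n) und und (λ ()) (λ ())) (Cyc-cospectral-union n 3≤n)
  , traceable-cospectral-with-union⇒¬DHS n (cycleWith (2 * n) fwd fwd)
      (cycleWith n fwd und) (cycleWith n fwd und) 1≤n
      (Cyc2≗cycleWith (2 * n)) (cycleWith-next (2 * n) fwd fwd (λ ()) (λ ())) (Cyc2-cospectral-union n 3≤n)
  where
  1≤n : 1 ≤ n
  1≤n = ℕ.≤-trans (s≤s z≤n) 3≤n
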